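{- Let $D$ be an $M\times N$ real-valued dataset and let $U,V$ be two borders of $D$. Then $U\subseteq V$ or $V\subseteq U$.
   Context: Let $A=\{(a,b): 1\le a\le M,\ 1\le b\le N\}$ and $D:A\to\mathbb{R}$. A corner is a set $U\subseteq A$ such that $(a,b)\in U$, $1\le x\le a$, $1\le y\le b$ imply $(x,y)\in U$. For nonempty $X\subseteq A$, $\mathrm{freq}(X)=\frac{1}{|X|}\sum_{c\in X}D(c)$. A corner $U$ is a border of $D$ if there are no corners $X,Y$ with $X\subsetneq U\subsetneq Y$ and $\mathrm{freq}(Y\setminus U)\ge \mathrm{freq}(U\setminus X)$. -}

module Defs where

open import Level using (Level; _⊔_) renaming (suc to lsuc)
open import Data.Nat using (ℕ; zero; suc)
open import Data.Fin using (Fin; zero; suc) renaming (_≤_ to _≤ᶠ_)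
open import Data.Bool using (Bool; true; false; _∧_; not; if_then_else_)
open import Data.Product using (Σ; _×_; _,_; ∃)
open import Relation.Binary.PropositionalEquality using (_≡_)
open import Relation.Binary.Core using (Rel)
open import Relation.Binary.Structures using (IsTotalOrder)
open import Relation.Nullary using (¬_)
open import Algebra.Bundles using (CommutativeRing)

-- Ordered fields (the reals are one; the statement is stated for every
-- ordered field).  _⁻¹ is a total operation whose value
-- on 0 is unconstrained.

record OrderedField (c ℓ₁ ℓ₂ : Level) : Set (lsuc (c ⊔ ℓ₁ ⊔ ℓ₂)) where
  field
    commutativeRing : CommutativeRing c ℓ₁
  open CommutativeRing commutativeRing public
  infix 4 _≤_
  infix 8 _⁻¹
  field
    _≤_          : Rel Carrier ℓ₂
    isTotalOrder : IsTotalOrder _≈_ _≤_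
    +-monoˡ-≤    : ∀ {x y} z → x ≤ y → (x + z) ≤ (y + z)
    *-nonneg     : ∀ {x y} → 0# ≤ x → 0# ≤ y → 0# ≤ (x * y)
    0≉1          : ¬ (0# ≈ 1#)
    _⁻¹          : Carrier → Carrier
    ⁻¹-inverse   : ∀ x → ¬ (x ≈ 0#) → (x * x ⁻¹) ≈ 1#

-- The grid A = {1..M} × {1..N} is represented 0-indexed as Fin M × Fin N.
-- Subsets of A are decidable: Fin M → Fin N → Bool.

Subset : ℕ → ℕ → Set
Subset M N = Fin M → Fin N → Bool

_∈_ : ∀ {M N} → Fin M × Fin N → Subset M N → Set
(a , b) ∈ U = U a b ≡ true

_⊆_ : ∀ {M N} → Subset M N → Subset M N → Set
U ⊆ V = ∀ a b → U a b ≡ true → V a b ≡ true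

_⊂_ : ∀ {M N} → Subset M N → Subset M N → Set
U ⊂ V = U ⊆ V × ∃ λ p → p ∈ V × ¬ (p ∈ U)

_∖_ : ∀ {M N} → Subset M N → Subset M N → Subset M N
(Y ∖ U) a b = Y a b ∧ not (U a b)

IsCorner : ∀ {M N} → Subset M N → Set
IsCorner U = ∀ a b x y → U a b ≡ true → x ≤ᶠ a → y ≤ᶠ b → U x y ≡ true

module _ {c ℓ₁ ℓ₂} (F : OrderedField c ℓ₁ ℓ₂) where
  open OrderedField F using (Carrier; _+_; _*_; 0#; 1#; _⁻¹; _≤_)

  ΣFin : (n : ℕ) → (Fin n → Carrier) → Carrier
  ΣFin zero    f = 0#
  ΣFin (suc n) f = f zero + ΣFin n (λ i → f (suc i))

  fromℕ : ℕ → Carrier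
  fromℕ zero    = 0#
  fromℕ (suc n) = 1# + fromℕ n

  sumOver : ∀ {M N} → (Fin M → Fin N → Carrier) → Subset M N → Carrier
  sumOver {M} {N} D X =
    ΣFin M (λ a → ΣFin N (λ b → if X a b then D a b else 0#))

  card : ∀ {M N} → Subset M N → Carrier
  card {M} {N} X = ΣFin M (λ a → ΣFin N (λ b → if X a b then 1# else 0#))

  -- freq(X) = (1/|X|) Σ_{c∈X} D(c)   (only meaningful for nonempty X)
  freq : ∀ {M N} → (Fin M → Fin N → Carrier) → Subset M N → Carrier
  freq D X = card X ⁻¹ * sumOver D X

  IsBorder : ∀ {M N} → (Fin M → Fin N → Carrier) → Subset M N → Set ℓ₂
  IsBorder {M} {N} D U =
    IsCorner U ×
    (∀ (X Y : Subset M N) → IsCorner X → IsCorner Y → X ⊂ U → U ⊂ Y →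
       ¬ (freq D (U ∖ X) ≤ freq D (Y ∖ U)))

-- If neither of two borders U, V contains the other, compare both with the
-- corners U ∩ V ⊂ U, V ⊂ U ∪ V.  Since (U ∪ V) ∖ U = V ∖ U and U ∖ (U ∩ V) =
-- U ∖ V, the border property of U gives freq (V ∖ U) < freq (U ∖ V), and
-- that of V gives the reverse strict inequality.
module Submission where

open import Defs
open import Data.Nat using (ℕ)
open import Data.Fin using (Fin)
open import Data.Fin.Properties using (any?)
open import Data.Bool using (true; false; _∧_; _∨_; if_then_else_)
open import Data.Bool.Properties using (∧-zeroʳ) renaming (_≟_ to _≟ᵇ_)
open import Data.Sum using (_⊎_; inj₁; inj₂; [_,_])
open import Data.Empty using (⊥-elim)
open import Data.Product using (_×_; _,_; ∃; proj₁; proj₂)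
open import Function using (_∘_)
open import Relation.Nullary using (¬_; yes; no)
open import Relation.Binary.PropositionalEquality using (_≡_; refl; sym; cong; cong₂)
open import Relation.Binary.Structures using (IsTotalOrder)

private
  variable
    M N : ℕ

_∩_ : Subset M N → Subset M N → Subset M N
(U ∩ V) a b = U a b ∧ V a b

_∪_ : Subset M N → Subset M N → Subset M N
(U ∪ V) a b = U a b ∨ V a b

_≐_ : Subset M N → Subset M N → Set
U ≐ V = ∀ a b → U a b ≡ V a b

∩-isCorner : {U V : Subset M N} → IsCorner U → IsCorner V → IsCorner (U ∩ V)
∩-isCorner {U = U} {V} cU cV a b x y a,b∈ x≤a y≤b with U a b in a,b∈U | V a b in a,b∈V
... | true | true rewrite cU a b x y a,b∈U x≤a y≤b | cV a b x y a,b∈V x≤a y≤b = refl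

∪-isCorner : {U V : Subset M N} → IsCorner U → IsCorner V → IsCorner (U ∪ V)
∪-isCorner {U = U} cU cV a b x y a,b∈ x≤a y≤b with U a b in a,b∈U
... | true rewrite cU a b x y a,b∈U x≤a y≤b = refl
... | false with U x y
...   | true  = refl
...   | false = cV a b x y a,b∈ x≤a y≤b

∈-∖⁻ : {U V : Subset M N} {a : Fin M} {b : Fin N} →
       (a , b) ∈ (U ∖ V) → (a , b) ∈ U × ¬ ((a , b) ∈ V)
∈-∖⁻ {U = U} {V} {a} {b} a,b∈ with U a b | V a b
... | true | false = refl , λ ()

∈-∖⁺ : {U V : Subset M N} {a : Fin M} {b : Fin N} →
       (a , b) ∈ U → V a b ≡ false → (a , b) ∈ (U ∖ V)
∈-∖⁺ a,b∈U a,b∉V rewrite a,b∈U | a,b∉V = refl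

⊆⊎∃∖ : (U V : Subset M N) → U ⊆ V ⊎ ∃ λ p → p ∈ (U ∖ V)
⊆⊎∃∖ U V with any? (λ a → any? (λ b → (U ∖ V) a b ≟ᵇ true))
... | yes (a , b , a,b∈) = inj₂ ((a , b) , a,b∈)
... | no ∄ = inj₁ U⊆V
  where
  U⊆V : U ⊆ V
  U⊆V a b a,b∈U with V a b in a,b∉V
  ... | true  = refl
  ... | false = ⊥-elim (∄ (a , b , ∈-∖⁺ {U = U} {V} a,b∈U a,b∉V))

∩-⊂ˡ : {U W : Subset M N} {p : Fin M × Fin N} → p ∈ (U ∖ W) → (U ∩ W) ⊂ U
∩-⊂ˡ {U = U} {W} {p} p∈U∖W = ∩-⊆ˡ , p , p∈U , p∉W ∘ ∩-⊆ʳ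
  where
  ∩-⊆ˡ : (U ∩ W) ⊆ U
  ∩-⊆ˡ a b a,b∈ with U a b
  ... | true = refl
  ∩-⊆ʳ : ∀ {a b} → (a , b) ∈ (U ∩ W) → (a , b) ∈ W
  ∩-⊆ʳ {a} {b} a,b∈ with U a b
  ... | true = a,b∈
  p∈U = proj₁ (∈-∖⁻ {U = U} {W} p∈U∖W)
  p∉W = proj₂ (∈-∖⁻ {U = U} {W} p∈U∖W)

⊂-∪ʳ : {U W : Subset M N} {q : Fin M × Fin N} → q ∈ (W ∖ U) → U ⊂ (U ∪ W)
⊂-∪ʳ {U = U} {W} {q , q′} q∈W∖U = ∪-⊇ˡ , (q , q′) , ∪-⊇ʳ q q′ q∈W , q∉U
  where
  ∪-⊇ˡ : U ⊆ (U ∪ W)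
  ∪-⊇ˡ a b a,b∈U rewrite a,b∈U = refl
  ∪-⊇ʳ : W ⊆ (U ∪ W)
  ∪-⊇ʳ a b a,b∈W with U a b
  ... | true  = refl
  ... | false = a,b∈W
  q∈W = proj₁ (∈-∖⁻ {U = W} {U} q∈W∖U)
  q∉U = proj₂ (∈-∖⁻ {U = W} {U} q∈W∖U)

∖-∩ : (U W : Subset M N) → (U ∖ (U ∩ W)) ≐ (U ∖ W)
∖-∩ U W a b with U a b
... | true  = refl
... | false = refl

∪-∖ : (U W : Subset M N) → ((U ∪ W) ∖ U) ≐ (W ∖ U)
∪-∖ U W a b with U a b
... | true  = sym (∧-zeroʳ (W a b))
... | false = refl

module _ {c ℓ₁ ℓ₂} (F : OrderedField c ℓ₁ ℓ₂) where
  open OrderedField F using (Carrier; _*_; _+_; _⁻¹; 0#; 1#; _≤_)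

  ΣFin-cong : ∀ n {f g : Fin n → Carrier} → (∀ i → f i ≡ g i) → ΣFin F n f ≡ ΣFin F n g
  ΣFin-cong ℕ.zero    f≗g = refl
  ΣFin-cong (ℕ.suc n) f≗g = cong₂ _+_ (f≗g Fin.zero) (ΣFin-cong n (f≗g ∘ Fin.suc))

  sumOver-cong : (E : Fin M → Fin N → Carrier) {X Y : Subset M N} →
                 X ≐ Y → sumOver F E X ≡ sumOver F E Y
  sumOver-cong {M} {N} E X≐Y =
    ΣFin-cong M (λ a → ΣFin-cong N (λ b → cong (if_then E a b else 0#) (X≐Y a b)))

  freq-cong : (D : Fin M → Fin N → Carrier) {X Y : Subset M N} →
              X ≐ Y → freq F D X ≡ freq F D Y
  freq-cong D X≐Y =
    cong₂ _*_ (cong _⁻¹ (sumOver-cong (λ _ _ → 1#) X≐Y)) (sumOver-cong D X≐Y)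

  border-freq : (D : Fin M → Fin N → Carrier) {U W : Subset M N} {p q : Fin M × Fin N} →
                IsBorder F D U → IsCorner W → p ∈ (U ∖ W) → q ∈ (W ∖ U) →
                ¬ (freq F D (U ∖ W) ≤ freq F D (W ∖ U))
  border-freq D {U} {W} (cornerU , borderU) cornerW p∈U∖W q∈W∖U
    rewrite sym (freq-cong D (∖-∩ U W)) | sym (freq-cong D (∪-∖ U W)) =
    borderU (U ∩ W) (U ∪ W) (∩-isCorner cornerU cornerW) (∪-isCorner cornerU cornerW)
            (∩-⊂ˡ p∈U∖W) (⊂-∪ʳ q∈W∖U)

proposition2 : ∀ {c ℓ₁ ℓ₂} (F : OrderedField c ℓ₁ ℓ₂) (M N : ℕ)
                 (D : Fin M → Fin N → OrderedField.Carrier F)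
                 (U V : Subset M N) →
                 IsBorder F D U → IsBorder F D V → U ⊆ V ⊎ V ⊆ U
proposition2 F M N D U V borderU borderV with ⊆⊎∃∖ U V | ⊆⊎∃∖ V U
... | inj₁ U⊆V | _        = inj₁ U⊆V
... | _        | inj₁ V⊆U = inj₂ V⊆U
... | inj₂ (_ , p∈U∖V) | inj₂ (_ , q∈V∖U) =
  ⊥-elim ([ border-freq F D borderU (proj₁ borderV) p∈U∖V q∈V∖U
          , border-freq F D borderV (proj₁ borderU) q∈V∖U p∈U∖V
          ] (IsTotalOrder.total (OrderedField.isTotalOrder F) _ _))
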